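{- Let $G$ be a connected graph and $k$ a positive integer. Then $G$ admits a strongly $k$-uniform integer additive set-indexer if and only if $G$ is bipartite or $G$ admits a $(k,l)$-completely uniform integer additive set-indexer with $k=l^2$.
   Context: All graphs are simple, finite and have no isolated vertices. Set-labels are non-empty finite subsets of the non-negative integers $\mathbb{N}_0$. For sets $A,B$, $A+B=\{a+b: a\in A, b\in B\}$. An integer additive set-indexer (IASI) of $G$ is an injective $f:V(G)\to 2^{\mathbb{N}_0}$ such that $f^+:E(G)\to 2^{\mathbb{N}_0}$, $f^+(uv)=f(u)+f(v)$, is injective. An IASI is $k$-uniform if $|f^+(e)|=k$ for all edges $e$. It is strong if $|f^+(uv)|=|f(u)|\,|f(v)|$ for every edge $uv$, and strongly $k$-uniform if it is strong and $k$-uniform. An IASI $f$ is $(k,l)$-completely uniform if it is $k$-uniform and $|f(v)|=l$ for every vertex $v$. -}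

module Defs where

open import Data.Nat using (ℕ; _≟_; _*_; _+_)
open import Data.Fin using (Fin)
open import Data.Bool using (Bool)
open import Data.List using (List; []; length; deduplicate; concatMap; map)
open import Data.List.Membership.Propositional using (_∈_)
open import Data.Product using (Σ; ∃; _×_; _,_)
open import Data.Sum using (_⊎_)
open import Relation.Binary.PropositionalEquality using (_≡_; _≢_)
open import Relation.Binary.Construct.Closure.ReflexiveTransitive using (Star)
open import Relation.Nullary using (¬_)
open import Level using (0ℓ)
open import Relation.Binary using (Rel)

record Graph : Set₁ where
  field
    n        : ℕ
    Adj      : Fin n → Fin n → Set
    sym      : ∀ {u v} → Adj u v → Adj v u
    irrefl   : ∀ {u} → ¬ Adj u u
    noIsolated : ∀ u → ∃ λ v → Adj u v
open Graph public

Connected : Graph → Set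
Connected G = ∀ u v → Star (Adj G) u v

Bipartite : Graph → Set
Bipartite G = Σ (Fin (n G) → Bool) λ c → ∀ {u v} → Adj G u v → c u ≢ c v

-- Finite subsets of ℕ represented by lists (duplicates allowed);
-- set equality is extensional membership equality.
FinSet : Set
FinSet = List ℕ

_≈ₛ_ : FinSet → FinSet → Set
A ≈ₛ B = ∀ x → (x ∈ A → x ∈ B) × (x ∈ B → x ∈ A)

∣_∣ₛ : FinSet → ℕ
∣ A ∣ₛ = length (deduplicate _≟_ A)

_⊕_ : FinSet → FinSet → FinSet
A ⊕ B = concatMap (λ a → map (a +_) B) A

module _ (G : Graph) where
  V : Set
  V = Fin (n G)

  edgeLabel : (V → FinSet) → V → V → FinSet
  edgeLabel f u v = f u ⊕ f v

  record IsIASI (f : V → FinSet) : Set where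
    field
      nonempty : ∀ v → f v ≢ []
      injective : ∀ u v → f u ≈ₛ f v → u ≡ v
      edgeInjective : ∀ u v x y → Adj G u v → Adj G x y →
        edgeLabel f u v ≈ₛ edgeLabel f x y →
        (u ≡ x × v ≡ y) ⊎ (u ≡ y × v ≡ x)

  IsKUniform : ℕ → (V → FinSet) → Set
  IsKUniform k f = IsIASI f × (∀ u v → Adj G u v → ∣ edgeLabel f u v ∣ₛ ≡ k)

  IsStrong : (V → FinSet) → Set
  IsStrong f = IsIASI f × (∀ u v → Adj G u v → ∣ edgeLabel f u v ∣ₛ ≡ ∣ f u ∣ₛ * ∣ f v ∣ₛ)

  IsStronglyKUniform : ℕ → (V → FinSet) → Set
  IsStronglyKUniform k f = IsStrong f × IsKUniform k f

  IsCompletelyUniform : ℕ → ℕ → (V → FinSet) → Set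
  IsCompletelyUniform k l f = IsKUniform k f × (∀ v → ∣ f v ∣ₛ ≡ l)

-- If f is strongly k-uniform then ∣f u∣·∣f v∣ = k on every edge, so along a path the vertex
-- sizes alternate between a = ∣f r∣ and the size b of a neighbour of r.  If a = b then
-- k = a² and f is (k, a)-completely uniform; otherwise colouring by "size = a" is proper.
-- Conversely, given a proper 2-colouring, label the vertex with index i by {i·N} on one side
-- and by {i, …, i+k−1} on the other (N larger than every index).  Every edge label is then an
-- interval of length k starting at i·N + j, whose base-N digits recover the edge.
module Submission where

open import Defs hiding (sym)
open import Data.Nat using (ℕ; zero; suc; _+_; _*_; _≤_; _<_; _≟_; NonZero; z<s)
open import Data.Nat.Properties
  using ( ≤-refl; ≤-trans; ≤-antisym; n≤1+n; <⇒≢; m<n⇒m<1+n; +-comm; +-suc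
        ; +-identityʳ; *-identityʳ; *-comm; +-cancelʳ-≡; *-cancelʳ-≡; *-cancelˡ-≡)
open import Data.Nat.DivMod using (_%_; [m+kn]%n≡m%n; m<n⇒m%n≡m)
open import Data.Fin using (Fin; toℕ; zero)
open import Data.Fin.Properties using (toℕ-injective; toℕ<n; ¬Fin0)
open import Data.Bool using (Bool; true; false)
open import Data.List using ([]; _∷_; map; length; deduplicate)
open import Data.List.Properties using (filter-all; ++-identityʳ)
import Data.List.Relation.Unary.All as All
open import Data.List.Relation.Unary.Any using (here; there)
open import Data.List.Membership.Propositional using (_∈_)
open import Data.Product using (Σ; _×_; _,_; proj₁; proj₂)
open import Data.Product.Properties using (×-≡,≡→≡)
open import Data.Sum using (_⊎_; inj₁; inj₂; [_,_]′)
open import Function using (_∘_; id)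
open import Function.Bundles using (_⇔_; mk⇔)
open import Relation.Nullary using (¬_; Dec; yes; no; does; ¬?; contradiction)
open import Relation.Binary.PropositionalEquality
  using (_≡_; _≢_; refl; sym; trans; cong; cong₂; subst; module ≡-Reasoning)
open import Relation.Binary.Construct.Closure.ReflexiveTransitive using (Star; ε; _◅_)
import Data.Sum as Sum
import Data.Product as Product

Least : ℕ → FinSet → Set
Least a A = a ∈ A × (∀ {z} → z ∈ A → a ≤ z)

least-unique-≈ₛ : ∀ {A B a b} → A ≈ₛ B → Least a A → Least b B → a ≡ b
least-unique-≈ₛ {a = a} {b} A≈B (a∈A , a≤A) (b∈B , b≤B) =
  ≤-antisym (a≤A (proj₂ (A≈B b) b∈B)) (b≤B (proj₁ (A≈B a) a∈A))

interval : ℕ → ℕ → FinSet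
interval a zero    = []
interval a (suc m) = a ∷ interval (suc a) m

interval-lowerBound : ∀ {a z} m → z ∈ interval a m → a ≤ z
interval-lowerBound     (suc m) (here refl) = ≤-refl
interval-lowerBound {a} (suc m) (there z∈) = ≤-trans (n≤1+n a) (interval-lowerBound m z∈)

interval-least : ∀ a m → Least a (interval a (suc m))
interval-least a m = here refl , interval-lowerBound (suc m)

deduplicate-interval : ∀ a m → deduplicate _≟_ (interval a m) ≡ interval a m
deduplicate-interval a zero    = refl
deduplicate-interval a (suc m) rewrite deduplicate-interval (suc a) m =
  cong (a ∷_) (filter-all (¬? ∘ (a ≟_)) (All.tabulate (<⇒≢ ∘ interval-lowerBound m)))

length-interval : ∀ a m → length (interval a m) ≡ m
length-interval a zero    = refl
length-interval a (suc m) = cong suc (length-interval (suc a) m)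

∣interval∣ : ∀ a m → ∣ interval a m ∣ₛ ≡ m
∣interval∣ a m rewrite deduplicate-interval a m = length-interval a m

map-+-interval : ∀ a b m → map (a +_) (interval b m) ≡ interval (a + b) m
map-+-interval a b zero = refl
map-+-interval a b (suc m) rewrite map-+-interval a (suc b) m | +-suc a b = refl

singleton-⊕-interval : ∀ a b m → (a ∷ []) ⊕ interval b m ≡ interval (a + b) m
singleton-⊕-interval a b m = trans (++-identityʳ _) (map-+-interval a b m)

interval-⊕-singleton : ∀ a b m → interval a m ⊕ (b ∷ []) ≡ interval (a + b) m
interval-⊕-singleton a b zero    = refl
interval-⊕-singleton a b (suc m) = cong (a + b ∷_) (interval-⊕-singleton (suc a) b m)

digits-injective : ∀ N .{{_ : NonZero N}} {h l h′ l′} → l < N → l′ < N →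
                   h * N + l ≡ h′ * N + l′ → h ≡ h′ × l ≡ l′
digits-injective N {h} {l} {h′} {l′} l<N l′<N eq = high , low
  where
  lowDigit : ∀ h {l} → l < N → (h * N + l) % N ≡ l
  lowDigit h {l} l<N =
    trans (cong (_% N) (+-comm (h * N) l)) (trans ([m+kn]%n≡m%n l h N) (m<n⇒m%n≡m l<N))

  low : l ≡ l′
  low = trans (sym (lowDigit h l<N)) (trans (cong (_% N) eq) (lowDigit h′ l′<N))

  high : h ≡ h′
  high = *-cancelʳ-≡ h h′ N (+-cancelʳ-≡ l (h * N) (h′ * N) (trans eq (cong (h′ * N +_) (sym low))))

*-cofactor-unique : ∀ {m} x {y z} → x * y ≡ suc m → x * z ≡ suc m → y ≡ z
*-cofactor-unique (suc x) xy≡k xz≡k = *-cancelˡ-≡ _ _ (suc x) (trans xy≡k (sym xz≡k))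

Star-transport : ∀ {A : Set} {R : A → A → Set} (P : A → Set) →
                 (∀ {x y} → R x y → P x → P y) → ∀ {x y} → Star R x y → P x → P y
Star-transport P step ε        px = px
Star-transport P step (r ◅ rs) px = Star-transport P step rs (step r px)

Fin-inhabited? : ∀ n → Dec (Fin n)
Fin-inhabited? zero    = no ¬Fin0
Fin-inhabited? (suc n) = yes zero

emptyGraph-bipartite : (G : Graph) → ¬ V G → Bipartite G
emptyGraph-bipartite G noVertex = (λ _ → true) , λ {u} _ → contradiction u noVertex

completelyUniform⇒stronglyUniform : (G : Graph) → ∀ {k l f} → k ≡ l * l →
  IsCompletelyUniform G k l f → IsStronglyKUniform G k f
completelyUniform⇒stronglyUniform G k≡l² ((iasi , uniform) , ∣f∣≡l) =
  (iasi , λ u v uv → trans (uniform u v uv) (trans k≡l² (cong₂ _*_ (sym (∣f∣≡l u)) (sym (∣f∣≡l v)))))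
  , (iasi , uniform)

module BipartiteLabelling (G : Graph) (c : V G → Bool)
                          (proper : ∀ {u v} → Adj G u v → c u ≢ c v) (m : ℕ) where
  N : ℕ
  N = suc (n G)

  index< : ∀ (w : V G) → toℕ w < N
  index< w = m<n⇒m<1+n (toℕ<n w)

  anchor : Bool → ℕ → ℕ
  anchor true  i = i * N
  anchor false i = i

  width : Bool → ℕ
  width true  = 1
  width false = suc m

  label : Bool → ℕ → FinSet
  label b i = interval (anchor b i) (width b)

  label-least : ∀ b i → Least (anchor b i) (label b i)
  label-least true  i = interval-least (i * N) 0
  label-least false i = interval-least i m

  label-nonempty : ∀ b i → label b i ≢ []
  label-nonempty true  i ()
  label-nonempty false i ()

  label-⊕ : ∀ {b b′} → b ≢ b′ → ∀ i j →
            label b i ⊕ label b′ j ≡ interval (anchor b i + anchor b′ j) (suc m)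
  label-⊕ {true}  {true}  b≢b′ i j = contradiction refl b≢b′
  label-⊕ {true}  {false} b≢b′ i j = singleton-⊕-interval (i * N) j (suc m)
  label-⊕ {false} {true}  b≢b′ i j = interval-⊕-singleton i (j * N) (suc m)
  label-⊕ {false} {false} b≢b′ i j = contradiction refl b≢b′

  width-* : ∀ {b b′} → b ≢ b′ → width b * width b′ ≡ suc m
  width-* {true}  {true}  b≢b′ = contradiction refl b≢b′
  width-* {true}  {false} b≢b′ = +-identityʳ (suc m)
  width-* {false} {true}  b≢b′ = *-identityʳ (suc m)
  width-* {false} {false} b≢b′ = contradiction refl b≢b′

  anchor-injective : ∀ b b′ {i j} → i < N → j < N → anchor b i ≡ anchor b′ j → i ≡ j
  anchor-injective true  true  {i} {j} _ _ eq = *-cancelʳ-≡ i j N eq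
  anchor-injective false false         _ _ eq = eq
  anchor-injective true  false {i} {j} _ j<N eq =
    let (i≡0 , 0≡j) = digits-injective N z<s j<N (trans (+-identityʳ (i * N)) eq) in trans i≡0 0≡j
  anchor-injective false true  {i} {j} i<N _ eq =
    let (0≡j , i≡0) = digits-injective N i<N z<s (trans eq (sym (+-identityʳ (j * N)))) in trans i≡0 0≡j

  -- For b the colour of i: (index of the `true` end, index of the `false` end) of the edge ij.
  orient : Bool → ℕ → ℕ → ℕ × ℕ
  orient true  i j = i , j
  orient false i j = j , i

  orient-injective : ∀ b b′ {i j p q} → orient b i j ≡ orient b′ p q → (i ≡ p × j ≡ q) ⊎ (i ≡ q × j ≡ p)
  orient-injective true  true  refl = inj₁ (refl , refl)
  orient-injective true  false refl = inj₂ (refl , refl)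
  orient-injective false true  refl = inj₂ (refl , refl)
  orient-injective false false refl = inj₁ (refl , refl)

  orient₂< : ∀ b {i j} → i < N → j < N → proj₂ (orient b i j) < N
  orient₂< true  i<N j<N = j<N
  orient₂< false i<N j<N = i<N

  encode : ℕ × ℕ → ℕ
  encode p = proj₁ p * N + proj₂ p

  encode-injective : ∀ {p q} → proj₂ p < N → proj₂ q < N → encode p ≡ encode q → p ≡ q
  encode-injective p₂<N q₂<N eq = ×-≡,≡→≡ (digits-injective N p₂<N q₂<N eq)

  anchor-+ : ∀ {b b′} → b ≢ b′ → ∀ i j → anchor b i + anchor b′ j ≡ encode (orient b i j)
  anchor-+ {true}  {true}  b≢b′ i j = contradiction refl b≢b′
  anchor-+ {true}  {false} b≢b′ i j = refl
  anchor-+ {false} {true}  b≢b′ i j = +-comm i (j * N)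
  anchor-+ {false} {false} b≢b′ i j = contradiction refl b≢b′

  f : V G → FinSet
  f w = label (c w) (toℕ w)

  start : V G → V G → ℕ
  start u v = anchor (c u) (toℕ u) + anchor (c v) (toℕ v)

  edgeLabel-interval : ∀ {u v} → Adj G u v → edgeLabel G f u v ≡ interval (start u v) (suc m)
  edgeLabel-interval uv = label-⊕ (proper uv) _ _

  edgeLabel-injective : ∀ u v x y → Adj G u v → Adj G x y → edgeLabel G f u v ≈ₛ edgeLabel G f x y →
                        (u ≡ x × v ≡ y) ⊎ (u ≡ y × v ≡ x)
  edgeLabel-injective u v x y uv xy eq =
    Sum.map (Product.map toℕ-injective toℕ-injective) (Product.map toℕ-injective toℕ-injective)
            (orient-injective (c u) (c x) (encode-injective (orient₂< (c u) (index< u) (index< v))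
                                               (orient₂< (c x) (index< x) (index< y)) sameCode))
    where
    open ≡-Reasoning
    least : ∀ {u v} → Adj G u v → Least (start u v) (edgeLabel G f u v)
    least uv = subst (Least _) (sym (edgeLabel-interval uv)) (interval-least _ m)

    sameCode : encode (orient (c u) (toℕ u) (toℕ v)) ≡ encode (orient (c x) (toℕ x) (toℕ y))
    sameCode = begin
      encode (orient (c u) (toℕ u) (toℕ v)) ≡⟨ sym (anchor-+ (proper uv) _ _) ⟩
      start u v                             ≡⟨ least-unique-≈ₛ eq (least uv) (least xy) ⟩
      start x y                             ≡⟨ anchor-+ (proper xy) _ _ ⟩
      encode (orient (c x) (toℕ x) (toℕ y)) ∎

  iasi : IsIASI G f
  iasi = record
    { nonempty      = λ w → label-nonempty (c w) (toℕ w)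
    ; injective     = λ u v eq → toℕ-injective (anchor-injective (c u) (c v) (index< u) (index< v)
                        (least-unique-≈ₛ eq (label-least (c u) (toℕ u)) (label-least (c v) (toℕ v))))
    ; edgeInjective = edgeLabel-injective
    }

  uniform : ∀ u v → Adj G u v → ∣ edgeLabel G f u v ∣ₛ ≡ suc m
  uniform u v uv rewrite edgeLabel-interval uv = ∣interval∣ (start u v) (suc m)

  strong : ∀ u v → Adj G u v → ∣ edgeLabel G f u v ∣ₛ ≡ ∣ f u ∣ₛ * ∣ f v ∣ₛ
  strong u v uv = begin
    ∣ edgeLabel G f u v ∣ₛ    ≡⟨ uniform u v uv ⟩
    suc m                     ≡⟨ sym (width-* (proper uv)) ⟩
    width (c u) * width (c v) ≡⟨ sym (cong₂ _*_ (∣interval∣ _ (width (c u))) (∣interval∣ _ (width (c v)))) ⟩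
    ∣ f u ∣ₛ * ∣ f v ∣ₛ       ∎
    where open ≡-Reasoning

bipartite⇒stronglyUniform : (G : Graph) → Bipartite G → ∀ m →
                            Σ (V G → FinSet) (IsStronglyKUniform G (suc m))
bipartite⇒stronglyUniform G (c , proper) m = f , (iasi , strong) , (iasi , uniform)
  where open BipartiteLabelling G c proper m

stronglyUniform-sizes : (G : Graph) → ∀ {k f} → IsStronglyKUniform G k f →
                        ∀ {u v} → Adj G u v → ∣ f u ∣ₛ * ∣ f v ∣ₛ ≡ k
stronglyUniform-sizes G ((_ , strong) , (_ , uniform)) {u} {v} uv =
  trans (sym (strong u v uv)) (uniform u v uv)

module SizeDichotomy (G : Graph) (connected : Connected G) (m : ℕ) (s : V G → ℕ)
                     (s-edge : ∀ {u v} → Adj G u v → s u * s v ≡ suc m) {r r′ : V G} (rr′ : Adj G r r′) where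
  r′r : s r′ * s r ≡ suc m
  r′r = trans (*-comm (s r′) (s r)) (s-edge rr′)

  twoValued : ∀ w → s w ≡ s r ⊎ s w ≡ s r′
  twoValued w = Star-transport (λ u → s u ≡ s r ⊎ s u ≡ s r′) step (connected r w) (inj₁ refl)
    where
    step : ∀ {u v} → Adj G u v → s u ≡ s r ⊎ s u ≡ s r′ → s v ≡ s r ⊎ s v ≡ s r′
    step {u} uv (inj₁ u≡r)  =
      inj₂ (*-cofactor-unique (s u) (s-edge uv) (trans (cong (_* s r′) u≡r) (s-edge rr′)))
    step {u} uv (inj₂ u≡r′) =
      inj₁ (*-cofactor-unique (s u) (s-edge uv) (trans (cong (_* s r) u≡r′) r′r))

  ≢r⇒≡r′ : ∀ w → s w ≢ s r → s w ≡ s r′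
  ≢r⇒≡r′ w w≢r = [ (λ w≡r → contradiction w≡r w≢r) , id ]′ (twoValued w)

  square⇒equal : ∀ w → s w * s w ≡ suc m → s r ≡ s r′
  square⇒equal w sq with twoValued w
  ... | inj₁ w≡r  = *-cofactor-unique (s r) (subst (λ a → a * a ≡ suc m) w≡r sq) (s-edge rr′)
  ... | inj₂ w≡r′ = sym (*-cofactor-unique (s r′) (subst (λ a → a * a ≡ suc m) w≡r′ sq) r′r)

  edge-distinct : s r ≢ s r′ → ∀ {u v} → Adj G u v → s u ≢ s v
  edge-distinct r≢r′ {u} uv u≡v = r≢r′ (square⇒equal u (trans (cong (s u *_) u≡v) (s-edge uv)))

  colours-differ : ∀ {u v} → s u ≢ s v → (u≟r : Dec (s u ≡ s r)) (v≟r : Dec (s v ≡ s r)) →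
                   does u≟r ≢ does v≟r
  colours-differ u≢v (yes u≡r) (yes v≡r) _ = u≢v (trans u≡r (sym v≡r))
  colours-differ u≢v (yes _)   (no _)    ()
  colours-differ u≢v (no _)    (yes _)   ()
  colours-differ {u} {v} u≢v (no u≢r) (no v≢r) _ = u≢v (trans (≢r⇒≡r′ u u≢r) (sym (≢r⇒≡r′ v v≢r)))

  bipartite⊎constant : Bipartite G ⊎ (suc m ≡ s r * s r × ∀ w → s w ≡ s r)
  bipartite⊎constant with s r ≟ s r′
  ... | yes r≡r′ = inj₂ ( trans (sym (s-edge rr′)) (cong (s r *_) (sym r≡r′))
                        , λ w → [ id , (λ w≡r′ → trans w≡r′ (sym r≡r′)) ]′ (twoValued w) )
  ... | no r≢r′  = inj₁ ( (λ w → does (s w ≟ s r))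
                        , λ {u} {v} uv → colours-differ (edge-distinct r≢r′ uv) (s u ≟ s r) (s v ≟ s r) )

stronglyUniform⇒bipartite⊎completelyUniform : (G : Graph) → Connected G → ∀ m {f} →
  IsStronglyKUniform G (suc m) f →
  Bipartite G ⊎ Σ ℕ (λ l → suc m ≡ l * l × Σ (V G → FinSet) (IsCompletelyUniform G (suc m) l))
stronglyUniform⇒bipartite⊎completelyUniform G connected m {f} st with Fin-inhabited? (n G)
... | no noVertex = inj₁ (emptyGraph-bipartite G noVertex)
... | yes r =
  Sum.map₂ (λ (k≡a² , constant) → ∣ f r ∣ₛ , k≡a² , f , proj₂ st , constant)
           (SizeDichotomy.bipartite⊎constant G connected m (∣_∣ₛ ∘ f) (stronglyUniform-sizes G st)
                                             (proj₂ (noIsolated G r)))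

theorem8 : (G : Graph) → Connected G → (k : ℕ) → NonZero k →
    (Σ (V G → FinSet) (IsStronglyKUniform G k))
      ⇔ (Bipartite G ⊎ Σ ℕ (λ l → k ≡ l * l × Σ (V G → FinSet) (IsCompletelyUniform G k l)))
theorem8 G connected zero    ()
theorem8 G connected (suc m) _  = mk⇔
  (stronglyUniform⇒bipartite⊎completelyUniform G connected m ∘ proj₂)
  [ (λ bip → bipartite⇒stronglyUniform G bip m)
  , (λ (l , k≡l² , f , cu) → f , completelyUniform⇒stronglyUniform G k≡l² cu) ]′
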